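{- For every digraph $G$, $\mathrm{d\text{ - }nw}(G)\le\mathrm{d\text{ - }lnlcw}(G)\le\mathrm{d\text{ - }nw}(G)+1$ and $\mathrm{d\text{ - }nw}(G)\le\mathrm{d\text{ - }lcw}(G)\le\mathrm{d\text{ - }nw}(G)+1$.
   Context: Digraphs $G=(V,E)$ are finite with $E\subseteq\{(u,v):u\ne v\}$. A layout is a bijection $\varphi:V\to\{1,\dots,|V|\}$; $L(i,\varphi)=\{u:\varphi(u)\le i\}$, $R(i,\varphi)=\{u:\varphi(u)>i\}$. With $N_i(u)=(\{v\in R(i,\varphi):(u,v)\in E\},\{v\in R(i,\varphi):(v,u)\in E\})$, $\mathrm{d\text{ - }nw}(G)=\min_\varphi\max_i|\{N_i(u):u\in L(i,\varphi)\}|$. $\mathrm{d\text{ - }lnlcw}(G)$ is the least $k$ such that $G$ (under some labeling) is built from labeled digraphs with labels in $[k]$ by: $\bullet_a$ (a vertex labeled $a$); $H\otimes_{(\overrightarrow S,\overleftarrow S)}\bullet_a$ ($\overrightarrow S,\overleftarrow S\subseteq[k]^2$): add a new vertex $v$ labeled $a$ plus arcs $(u,v)$ for $u$ in $H$ of label $b$ with $(b,a)\in\overrightarrow S$ and arcs $(v,u)$ for $u$ in $H$ of label $b$ with $(b,a)\in\overleftarrow S$; $\circ_R$ ($R:[k]\to[k]$, relabel $a$ to $R(a)$). $\mathrm{d\text{ - }lcw}(G)$ is the least number of labels to build $G$ with $\bullet_a$, $H\oplus\bullet_a$ (add a new isolated vertex labeled $a$), $\alpha_{a,b}$ ($a\ne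 b$; add arcs from all label-$a$ to all label-$b$ vertices), $\rho_{a\to b}$ (relabel). -}

module Defs where

open import Data.Nat using (ℕ; zero; suc; _<ᵇ_; _≤_; _+_)
open import Data.Bool using (Bool; true; false; _∧_; _∨_; if_then_else_)
open import Data.Bool.Properties using () renaming (_≟_ to _≟ᴮ_)
open import Data.Fin using (Fin; zero; suc; toℕ)
open import Data.Fin.Properties using () renaming (_≟_ to _≟ᶠ_)
open import Data.Fin.Permutation using (Permutation′; _⟨$⟩ʳ_)
open import Data.List using (List; length; map; filter; deduplicate; allFin)
open import Data.Vec using (Vec; tabulate)
open import Data.Vec.Properties using (≡-dec)
open import Data.Product using (_×_; _,_; Σ; ∃)
open import Data.Product.Properties using () renaming (≡-dec to ×-≡-dec)
open import Relation.Nullary using (¬_)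
open import Relation.Nullary.Decidable using (⌊_⌋)
open import Relation.Binary.PropositionalEquality using (_≡_; _≢_)
open import Function using (_∘_)

record Digraph : Set where
  field
    n      : ℕ
    arc    : Fin n → Fin n → Bool
    irrefl : ∀ u → arc u u ≡ false

open Digraph public

-- Layouts and directed neighbourhood width.
-- A layout is a permutation φ of Fin n; the position of u is
-- toℕ (φ u) + 1 ∈ {1,…,n}.  Hence u ∈ L(i,φ) iff toℕ (φ u) < i.

Layout : ℕ → Set
Layout n = Permutation′ n

inL : ∀ {n} → Layout n → ℕ → Fin n → Bool
inL φ i u = toℕ (φ ⟨$⟩ʳ u) <ᵇ i

inR : ∀ {n} → Layout n → ℕ → Fin n → Bool
inR φ i u = if inL φ i u then false else true

-- N_i(u) = (out-neighbours of u in R(i,φ), in-neighbours of u in R(i,φ)),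
-- encoded as a pair of characteristic vectors over Fin n.
Nbh : (G : Digraph) → Layout (n G) → ℕ → Fin (n G) → Vec Bool (n G) × Vec Bool (n G)
Nbh G φ i u =
  tabulate (λ v → inR φ i v ∧ arc G u v) ,
  tabulate (λ v → inR φ i v ∧ arc G v u)

numClasses : (G : Digraph) → Layout (n G) → ℕ → ℕ
numClasses G φ i =
  length (deduplicate (×-≡-dec (≡-dec _≟ᴮ_) (≡-dec _≟ᴮ_))
           (map (Nbh G φ i) (filter (λ u → inL φ i u ≟ᴮ true) (allFin (n G)))))

HasDNW≤ : Digraph → ℕ → Set
HasDNW≤ G k = Σ (Layout (n G)) λ φ → ∀ (i : ℕ) → numClasses G φ i ≤ k

IsDNW : Digraph → ℕ → Set
IsDNW G k = HasDNW≤ G k × (∀ k′ → HasDNW≤ G k′ → k ≤ k′)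

record LDigraph (k m : ℕ) : Set where
  field
    larc  : Fin m → Fin m → Bool
    label : Fin m → Fin k

open LDigraph public

Iso : ∀ {k} (G : Digraph) → LDigraph k (n G) → Set
Iso G H = Σ (Permutation′ (n G)) λ π →
  ∀ u v → arc G (π ⟨$⟩ʳ u) (π ⟨$⟩ʳ v) ≡ larc H u v

-- Linear NLC-width expressions (the new vertex is zero, old ones are suc).

data LNLCExpr (k : ℕ) : ℕ → Set where
  vtx   : Fin k → LNLCExpr k 1
  ext   : ∀ {m} → LNLCExpr k m
        → (Sout Sin : Fin k → Fin k → Bool)
        → Fin k → LNLCExpr k (suc m)
  relab : ∀ {m} → LNLCExpr k m → (Fin k → Fin k) → LNLCExpr k m

⟦_⟧nlc : ∀ {k m} → LNLCExpr k m → LDigraph k m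
⟦ vtx a ⟧nlc = record { larc = λ _ _ → false ; label = λ _ → a }
⟦ ext {m = m} e Sout Sin a ⟧nlc = record { larc = A ; label = lab }
  where
    H = ⟦ e ⟧nlc
    A : Fin (suc m) → Fin (suc m) → Bool
    A zero    zero    = false
    A (suc u) zero    = Sout (label H u) a
    A zero    (suc u) = Sin  (label H u) a
    A (suc u) (suc w) = larc H u w
    lab : Fin (suc m) → _
    lab zero    = a
    lab (suc u) = label H u
⟦ relab e R ⟧nlc = record { larc = larc ⟦ e ⟧nlc ; label = R ∘ label ⟦ e ⟧nlc }

LNLCBuildable : Digraph → ℕ → Set
LNLCBuildable G k = ∃ λ (e : LNLCExpr k (n G)) → Iso G ⟦ e ⟧nlc

IsDLNLCW : Digraph → ℕ → Set
IsDLNLCW G k = LNLCBuildable G k × (∀ k′ → LNLCBuildable G k′ → k ≤ k′)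

-- Linear clique-width expressions (the new vertex is zero, old ones are suc).

data LCWExpr (k : ℕ) : ℕ → Set where
  vtx  : Fin k → LCWExpr k 1
  add  : ∀ {m} → LCWExpr k m → Fin k → LCWExpr k (suc m)
  arcs : ∀ {m} → LCWExpr k m → (a b : Fin k) → a ≢ b → LCWExpr k m
  rel  : ∀ {m} → LCWExpr k m → (a b : Fin k) → LCWExpr k m

_==_ : ∀ {k} → Fin k → Fin k → Bool
a == b = ⌊ a ≟ᶠ b ⌋

⟦_⟧lcw : ∀ {k m} → LCWExpr k m → LDigraph k m
⟦ vtx a ⟧lcw = record { larc = λ _ _ → false ; label = λ _ → a }
⟦ add {m = m} e a ⟧lcw = record { larc = A ; label = lab }
  where
    H = ⟦ e ⟧lcw
    A : Fin (suc m) → Fin (suc m) → Bool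
    A (suc u) (suc w) = larc H u w
    A _       _       = false
    lab : Fin (suc m) → _
    lab zero    = a
    lab (suc u) = label H u
⟦ arcs e a b _ ⟧lcw = record
  { larc  = λ u v → larc ⟦ e ⟧lcw u v ∨ (label ⟦ e ⟧lcw u == a ∧ label ⟦ e ⟧lcw v == b)
  ; label = label ⟦ e ⟧lcw }
⟦ rel e a b ⟧lcw = record
  { larc  = larc ⟦ e ⟧lcw
  ; label = λ u → if label ⟦ e ⟧lcw u == a then b else label ⟦ e ⟧lcw u }

LCWBuildable : Digraph → ℕ → Set
LCWBuildable G k = ∃ λ (e : LCWExpr k (n G)) → Iso G ⟦ e ⟧lcw

IsDLCW : Digraph → ℕ → Set
IsDLCW G k = LCWBuildable G k × (∀ k′ → LCWBuildable G k′ → k ≤ k′)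

module Submission where

-- Lower bounds (d-nw ≤ d-lnlcw, d-nw ≤ d-lcw): lay out the vertices of a
-- k-label expression in creation order.  At every time i, the labels of the
-- vertices created before i form a "class labelling": vertices with equal
-- labels have equal arcs to all later vertices, since later operations only
-- see labels.  Hence the cut at i has at most k neighbourhood classes.
--
-- Upper bounds (d-lnlcw, d-lcw ≤ d-nw + 1): along a layout of width k, label
-- the vertex p t at cut j by the index of its neighbourhood class N_j in the
-- list of classes met so far.  This "labelling scheme" has k labels, reads
-- the arcs of an old vertex to the next one off its label, and relabels old
-- vertices monotonically when a vertex is added.  One extra label for the
-- newest vertex then suffices to turn the scheme into a linear NLC-width
-- expression, and (using monotonicity to order the single relabellings ρ)
-- into a linear clique-width expression.

open import Defs
open import Data.Nat using (ℕ; zero; suc; _≤_; _<_; _+_; _∸_; _<ᵇ_; z≤n; s≤s; _≤?_)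
open import Data.Nat.Properties
  using ( ≤-refl; ≤-trans; ≤-pred; <⇒≤; <-≤-trans; ≤-<-trans; <-trans; <-irrefl; <⇒≱; ≰⇒>; ≮⇒≥; <ᵇ⇒<; <⇒<ᵇ
        ; m∸n≤m; m≤n⇒m≤1+n; m<n⇒m<1+n; m<1+n⇒m<n∨m≡n; suc-injective; +-comm)
open import Data.Bool using (Bool; true; false; _∧_; _∨_; if_then_else_; T)
open import Data.Bool.Properties using (∨-assoc; ∨-identityʳ; ∧-identityʳ; ∧-zeroʳ) renaming (_≟_ to _≟ᴮ_)
open import Data.Unit using (tt)
open import Data.Fin using (Fin; zero; suc; toℕ; punchOut)
open import Data.Fin.Properties using (punchOut-injective; toℕ-injective; opposite-prop) renaming (_≟_ to _≟ᶠ_)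
open import Data.Fin.Permutation using (Permutation′; _⟨$⟩ʳ_; _⟨$⟩ˡ_; _∘ₚ_; flip; reverse; inverseʳ)
open import Data.List using (List; []; _∷_; [_]; _++_; length; map; filter; deduplicate; allFin)
open import Data.List.Membership.Propositional using (_∈_)
open import Data.List.Membership.Propositional.Properties
  using (∈-map⁺; ∈-map⁻; ∈-deduplicate⁺; ∈-deduplicate⁻; ∈-filter⁺; ∈-filter⁻; ∈-allFin; ∈-++⁺ˡ; ∈-++⁺ʳ; ∈-++⁻)
open import Data.List.Relation.Binary.Subset.Propositional using (_⊆_)
open import Data.List.Relation.Unary.Any using (here; there; index)
open import Data.List.Relation.Unary.Any.Properties using (lookup-index)
open import Data.List.Relation.Unary.All as All using ()
open import Data.List.Relation.Unary.AllPairs using ([]; _∷_)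
open import Data.List.Relation.Unary.Unique.Propositional using (Unique)
open import Data.List.Relation.Unary.Unique.DecPropositional.Properties using (deduplicate-!)
open import Data.Vec using (Vec; tabulate; lookup)
open import Data.Vec.Properties using (≡-dec; tabulate-cong; lookup∘tabulate)
open import Data.Product using (_×_; _,_; Σ; proj₁; proj₂)
open import Data.Product.Properties using () renaming (≡-dec to ×-≡-dec)
open import Data.Sum using (inj₁; inj₂)
open import Data.Empty using (⊥-elim)
open import Relation.Nullary using (Dec; yes; no; ¬?)
open import Relation.Unary using (Decidable)
open import Relation.Binary.Definitions using (DecidableEquality)
open import Relation.Binary.PropositionalEquality using (_≡_; _≢_; refl; sym; trans; cong; cong₂; subst)
open Relation.Binary.PropositionalEquality.≡-Reasoning

unique-length≤ : ∀ {A : Set} {k} (xs : List A) → Unique xs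
  → (f : ∀ x → x ∈ xs → Fin k)
  → (∀ {x y} (x∈ : x ∈ xs) (y∈ : y ∈ xs) → f x x∈ ≡ f y y∈ → x ≡ y)
  → length xs ≤ k
unique-length≤ [] _ f inj = z≤n
unique-length≤ {k = zero} (a ∷ as) _ f inj with f a (here refl)
... | ()
unique-length≤ {k = suc k} (a ∷ as) (a∉as ∷ as!) f inj =
  s≤s (unique-length≤ as as! f′ inj′)
  where
  -- the image of a is missed by the rest, so the rest maps into Fin k
  missed : ∀ {x} (x∈ : x ∈ as) → f a (here refl) ≢ f x (there x∈)
  missed x∈ eq = All.lookup a∉as x∈ (inj (here refl) (there x∈) eq)
  f′ : ∀ x → x ∈ as → Fin k
  f′ x x∈ = punchOut (missed x∈)
  inj′ : ∀ {x y} (x∈ : x ∈ as) (y∈ : y ∈ as) → f′ x x∈ ≡ f′ y y∈ → x ≡ y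
  inj′ x∈ y∈ eq = inj (there x∈) (there y∈) (punchOut-injective (missed x∈) (missed y∈) eq)

unique-⊆-length≤ : ∀ {A : Set} (xs ys : List A) → Unique xs → xs ⊆ ys → length xs ≤ length ys
unique-⊆-length≤ xs ys xs! xs⊆ys = unique-length≤ xs xs! (λ _ x∈ → index (xs⊆ys x∈)) same
  where
  same : ∀ {x y} (x∈ : x ∈ xs) (y∈ : y ∈ xs) → index (xs⊆ys x∈) ≡ index (xs⊆ys y∈) → x ≡ y
  same x∈ y∈ eq = trans (lookup-index (xs⊆ys x∈))
                    (trans (cong (Data.List.lookup ys) eq) (sym (lookup-index (xs⊆ys y∈))))

module FirstIndex {A : Set} (_≟_ : DecidableEquality A) (default : A) where

  indexOf : List A → A → ℕ
  indexOf []       x = 0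
  indexOf (y ∷ ys) x with x ≟ y
  ... | yes _ = 0
  ... | no  _ = suc (indexOf ys x)

  entryAt : List A → ℕ → A
  entryAt []       _       = default
  entryAt (y ∷ ys) zero    = y
  entryAt (y ∷ ys) (suc c) = entryAt ys c

  entryAt-indexOf : ∀ xs {x} → x ∈ xs → entryAt xs (indexOf xs x) ≡ x
  entryAt-indexOf (y ∷ ys) {x} x∈ with x ≟ y
  entryAt-indexOf (y ∷ ys) x∈         | yes x≡y = sym x≡y
  entryAt-indexOf (y ∷ ys) (here x≡y) | no  x≢y = ⊥-elim (x≢y x≡y)
  entryAt-indexOf (y ∷ ys) (there x∈) | no  _   = entryAt-indexOf ys x∈

  indexOf<length : ∀ xs {x} → x ∈ xs → indexOf xs x < length xs
  indexOf<length (y ∷ ys) {x} x∈ with x ≟ y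
  indexOf<length (y ∷ ys) x∈         | yes _   = s≤s z≤n
  indexOf<length (y ∷ ys) (here x≡y) | no  x≢y = ⊥-elim (x≢y x≡y)
  indexOf<length (y ∷ ys) (there x∈) | no  _   = s≤s (indexOf<length ys x∈)

  indexOf-filter : ∀ {P : A → Set} (P? : Decidable P) xs {x} → P x
    → indexOf (filter P? xs) x ≤ indexOf xs x
  indexOf-filter P? []       px = z≤n
  indexOf-filter {P} P? (y ∷ ys) {x} px with P? y
  ... | yes _ with x ≟ y
  ...   | yes _ = z≤n
  ...   | no  _ = s≤s (indexOf-filter P? ys px)
  indexOf-filter {P} P? (y ∷ ys) {x} px | no ¬py with x ≟ y
  ...   | yes x≡y = ⊥-elim (¬py (subst P x≡y px))
  ...   | no  _   = m≤n⇒m≤1+n (indexOf-filter P? ys px)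

  indexOf-deduplicate-map : ∀ (g : A → A) xs ys {x} → x ∈ xs
    → indexOf (deduplicate _≟_ (map g xs ++ ys)) (g x) ≤ indexOf xs x
  indexOf-deduplicate-map g (z ∷ zs) ys {x} x∈ with x ≟ z | g x ≟ g z
  ... | yes _   | yes _    = z≤n
  ... | yes x≡z | no gx≢gz = ⊥-elim (gx≢gz (cong g x≡z))
  ... | no _    | yes _    = z≤n
  ... | no x≢z  | no gx≢gz = s≤s (≤-trans
        (indexOf-filter (λ w → ¬? (g z ≟ w)) (deduplicate _≟_ (map g zs ++ ys)) (λ e → gx≢gz (sym e)))
        (indexOf-deduplicate-map g zs ys (tail x∈)))
    where
    tail : x ∈ z ∷ zs → x ∈ zs
    tail (here x≡z) = ⊥-elim (x≢z x≡z)
    tail (there x∈) = x∈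

<ᵇ-true⇒< : ∀ {m n} → (m <ᵇ n) ≡ true → m < n
<ᵇ-true⇒< {m} {n} eq = <ᵇ⇒< m n (subst T (sym eq) tt)

<ᵇ-false⇒≥ : ∀ {m n} → (m <ᵇ n) ≡ false → n ≤ m
<ᵇ-false⇒≥ eq = ≮⇒≥ (λ m<n → subst T eq (<⇒<ᵇ m<n))

<⇒<ᵇ-true : ∀ {m n} → m < n → (m <ᵇ n) ≡ true
<⇒<ᵇ-true {m} {n} m<n with m <ᵇ n in eq
... | true  = refl
... | false = ⊥-elim (subst T eq (<⇒<ᵇ m<n))

≥⇒<ᵇ-false : ∀ {m n} → n ≤ m → (m <ᵇ n) ≡ false
≥⇒<ᵇ-false {m} {n} n≤m with m <ᵇ n in eq
... | true  = ⊥-elim (<⇒≱ (<ᵇ-true⇒< eq) n≤m)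
... | false = refl

inL⇒< : ∀ {m} (φ : Layout m) i u → inL φ i u ≡ true → toℕ (φ ⟨$⟩ʳ u) < i
inL⇒< φ i u = <ᵇ-true⇒<

inR⇒≥ : ∀ {m} (φ : Layout m) i u → inR φ i u ≡ true → i ≤ toℕ (φ ⟨$⟩ʳ u)
inR⇒≥ φ i u eq with inL φ i u in inL≡
... | false = <ᵇ-false⇒≥ inL≡

<⇒inL : ∀ {m} (φ : Layout m) i u → toℕ (φ ⟨$⟩ʳ u) < i → inL φ i u ≡ true
<⇒inL φ i u = <⇒<ᵇ-true

≥⇒inR : ∀ {m} (φ : Layout m) i u → i ≤ toℕ (φ ⟨$⟩ʳ u) → inR φ i u ≡ true
≥⇒inR φ i u i≤u rewrite ≥⇒<ᵇ-false {toℕ (φ ⟨$⟩ʳ u)} {i} i≤u = refl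

Nb : ℕ → Set
Nb m = Vec Bool m × Vec Bool m

_≟ᴺ_ : ∀ {m} (x y : Nb m) → Dec (x ≡ y)
_≟ᴺ_ = ×-≡-dec (≡-dec _≟ᴮ_) (≡-dec _≟ᴮ_)

Nbh-cong : ∀ G (φ : Layout (n G)) i x y
  → (∀ v → inR φ i v ≡ true → arc G x v ≡ arc G y v × arc G v x ≡ arc G v y)
  → Nbh G φ i x ≡ Nbh G φ i y
Nbh-cong G φ i x y same = cong₂ _,_ (tabulate-cong outs) (tabulate-cong ins)
  where
  outs : ∀ v → (inR φ i v ∧ arc G x v) ≡ (inR φ i v ∧ arc G y v)
  outs v with inR φ i v in v∈R
  ... | true  = proj₁ (same v v∈R)
  ... | false = refl
  ins : ∀ v → (inR φ i v ∧ arc G v x) ≡ (inR φ i v ∧ arc G v y)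
  ins v with inR φ i v in v∈R
  ... | true  = proj₂ (same v v∈R)
  ... | false = refl

numClasses≤ : ∀ G (φ : Layout (n G)) i k (f : Fin (n G) → Fin k)
  → (∀ x y → inL φ i x ≡ true → inL φ i y ≡ true → f x ≡ f y → Nbh G φ i x ≡ Nbh G φ i y)
  → numClasses G φ i ≤ k
numClasses≤ G φ i k f f-sound = unique-length≤ classes (deduplicate-! _≟ᴺ_ _) (λ c c∈ → f (rep c∈)) inj
  where
  inL? = λ u → inL φ i u ≟ᴮ true
  left = filter inL? (allFin (n G))
  classes = deduplicate _≟ᴺ_ (map (Nbh G φ i) left)
  witness : ∀ {c} → c ∈ classes → Σ (Fin (n G)) λ u → u ∈ left × c ≡ Nbh G φ i u
  witness c∈ = ∈-map⁻ (Nbh G φ i) (∈-deduplicate⁻ _≟ᴺ_ (map (Nbh G φ i) left) c∈)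
  rep : ∀ {c} → c ∈ classes → Fin (n G)
  rep c∈ = proj₁ (witness c∈)
  rep∈L : ∀ {c} (c∈ : c ∈ classes) → inL φ i (rep c∈) ≡ true
  rep∈L c∈ = proj₂ (∈-filter⁻ inL? {xs = allFin (n G)} (proj₁ (proj₂ (witness c∈))))
  inj : ∀ {c d} (c∈ : c ∈ classes) (d∈ : d ∈ classes) → f (rep c∈) ≡ f (rep d∈) → c ≡ d
  inj c∈ d∈ eq = trans (proj₂ (proj₂ (witness c∈)))
                   (trans (f-sound _ _ (rep∈L c∈) (rep∈L d∈) eq) (sym (proj₂ (proj₂ (witness d∈)))))

-- Creation time of vertex u of an expression with m vertices: the most
-- recently added vertex is zero, so u was created at time m ∸ suc u.
created : ∀ {m} → Fin m → ℕ
created {m} u = m ∸ suc (toℕ u)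

created<m : ∀ {m} (u : Fin m) → created u < m
created<m {suc m} u = s≤s (m∸n≤m m (toℕ u))

ClassLabelling : ∀ {k m} → LDigraph k m → ℕ → (Fin m → Fin k) → Set
ClassLabelling H i f = ∀ u w → created u < i → created w < i → f u ≡ f w →
  label H u ≡ label H w ×
  (∀ v → i ≤ created v → larc H u v ≡ larc H w v × larc H v u ≡ larc H v w)

HasClassLabelling : ∀ {k m} → LDigraph k m → ℕ → Set
HasClassLabelling {k} {m} H i = Σ (Fin m → Fin k) (ClassLabelling H i)

classLabelling-complete : ∀ {k m i} (H : LDigraph k m) → m ≤ i → ClassLabelling H i (label H)
classLabelling-complete H m≤i u w _ _ same =
  same , λ v i≤v → ⊥-elim (<⇒≱ (<-≤-trans (created<m v) m≤i) i≤v)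

classLabelling-extend : ∀ {k m i} (H : LDigraph k m) (H′ : LDigraph k (suc m)) → i ≤ m
  → (toNew fromNew : Fin k → Bool)
  → (∀ u → label H′ (suc u) ≡ label H u)
  → (∀ u w → larc H′ (suc u) (suc w) ≡ larc H u w)
  → (∀ u → larc H′ (suc u) zero ≡ toNew (label H u))
  → (∀ u → larc H′ zero (suc u) ≡ fromNew (label H u))
  → HasClassLabelling H i → HasClassLabelling H′ i
classLabelling-extend {k} {m} {i} H H′ i≤m toNew fromNew old-labels old-arcs to from (f , f-ok) = f′ , f′-ok
  where
  f′ : Fin (suc m) → Fin k
  f′ zero    = label H′ zero
  f′ (suc u) = f u
  f′-ok : ClassLabelling H′ i f′
  f′-ok zero    _       new<i _     _  = ⊥-elim (<⇒≱ new<i i≤m)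
  f′-ok (suc u) zero    _     new<i _  = ⊥-elim (<⇒≱ new<i i≤m)
  f′-ok (suc u) (suc w) u<i   w<i   eq with f-ok u w u<i w<i eq
  ... | same-label , same-arcs = trans (old-labels u) (trans same-label (sym (old-labels w))) , arcs′
    where
    arcs′ : ∀ v → i ≤ created v → larc H′ (suc u) v ≡ larc H′ (suc w) v × larc H′ v (suc u) ≡ larc H′ v (suc w)
    arcs′ zero    _   = trans (to u) (trans (cong toNew same-label) (sym (to w)))
                      , trans (from u) (trans (cong fromNew same-label) (sym (from w)))
    arcs′ (suc v) i≤v = trans (old-arcs u v) (trans (proj₁ (same-arcs v i≤v)) (sym (old-arcs w v)))
                      , trans (old-arcs v u) (trans (proj₂ (same-arcs v i≤v)) (sym (old-arcs v w)))

classLabelling-map : ∀ {k m i} (H H′ : LDigraph k m)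
  (R : Fin k → Fin k) (C : Bool → Fin k → Fin k → Bool)
  → (∀ u → label H′ u ≡ R (label H u))
  → (∀ u v → larc H′ u v ≡ C (larc H u v) (label H u) (label H v))
  → HasClassLabelling H i → HasClassLabelling H′ i
classLabelling-map H H′ R C new-labels new-arcs (f , f-ok) = f , f′-ok
  where
  f′-ok : ClassLabelling H′ _ f
  f′-ok u w u<i w<i eq with f-ok u w u<i w<i eq
  ... | same-label , same-arcs =
    trans (new-labels u) (trans (cong R same-label) (sym (new-labels w))) , λ v i≤v →
      trans (new-arcs u v) (trans (cong₂ (λ a l → C a l (label H v)) (proj₁ (same-arcs v i≤v)) same-label)
                                  (sym (new-arcs w v))) ,
      trans (new-arcs v u) (trans (cong₂ (λ a l → C a (label H v) l) (proj₂ (same-arcs v i≤v)) same-label)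
                                  (sym (new-arcs v w)))

classLabellingNLC : ∀ {k m} (e : LNLCExpr k m) i → HasClassLabelling ⟦ e ⟧nlc i
classLabellingNLC (vtx a) i = (λ _ → a) , λ _ _ _ _ _ → refl , λ _ _ → refl , refl
classLabellingNLC (ext {m} e Sout Sin a) i with i ≤? m
... | yes i≤m = classLabelling-extend ⟦ e ⟧nlc _ i≤m (λ b → Sout b a) (λ b → Sin b a)
                  (λ _ → refl) (λ _ _ → refl) (λ _ → refl) (λ _ → refl) (classLabellingNLC e i)
... | no  i≰m = _ , classLabelling-complete _ (≰⇒> i≰m)
classLabellingNLC (relab e R) i =
  classLabelling-map ⟦ e ⟧nlc _ R (λ b _ _ → b) (λ _ → refl) (λ _ _ → refl) (classLabellingNLC e i)

classLabellingLCW : ∀ {k m} (e : LCWExpr k m) i → HasClassLabelling ⟦ e ⟧lcw i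
classLabellingLCW (vtx a) i = (λ _ → a) , λ _ _ _ _ _ → refl , λ _ _ → refl , refl
classLabellingLCW (add {m} e a) i with i ≤? m
... | yes i≤m = classLabelling-extend ⟦ e ⟧lcw _ i≤m (λ _ → false) (λ _ → false)
                  (λ _ → refl) (λ _ _ → refl) (λ _ → refl) (λ _ → refl) (classLabellingLCW e i)
... | no  i≰m = _ , classLabelling-complete _ (≰⇒> i≰m)
classLabellingLCW (arcs e a b _) i =
  classLabelling-map ⟦ e ⟧lcw _ (λ l → l) (λ x l l′ → x ∨ (l == a ∧ l′ == b))
    (λ _ → refl) (λ _ _ → refl) (classLabellingLCW e i)
classLabellingLCW (rel e a b) i =
  classLabelling-map ⟦ e ⟧lcw _ (λ l → if l == a then b else l) (λ x _ _ → x)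
    (λ _ → refl) (λ _ _ → refl) (classLabellingLCW e i)

-- A labelled digraph isomorphic to G with class labellings (into k labels)
-- at all times yields a layout of G of width ≤ k: order vertices by creation.
width≤-from-labellings : ∀ G k (H : LDigraph k (n G)) → Iso G H
  → (∀ i → HasClassLabelling H i) → HasDNW≤ G k
width≤-from-labellings G k H (π , iso) labelling = φ , λ i → numClasses≤ G φ i k (f i) (f-sound i)
  where
  φ : Layout (n G)
  φ = flip π ∘ₚ reverse
  ι : Fin (n G) → Fin (n G)
  ι x = π ⟨$⟩ˡ x
  position : ∀ x → toℕ (φ ⟨$⟩ʳ x) ≡ created (ι x)
  position x = opposite-prop (ι x)
  arc-ι : ∀ x y → arc G x y ≡ larc H (ι x) (ι y)
  arc-ι x y = trans (cong₂ (arc G) (sym (inverseʳ π)) (sym (inverseʳ π))) (iso (ι x) (ι y))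
  f : ∀ i → Fin (n G) → Fin k
  f i x = proj₁ (labelling i) (ι x)
  f-sound : ∀ i x y → inL φ i x ≡ true → inL φ i y ≡ true → f i x ≡ f i y → Nbh G φ i x ≡ Nbh G φ i y
  f-sound i x y x∈L y∈L eq = Nbh-cong G φ i x y λ v v∈R →
    let same = proj₂ (proj₂ (labelling i) (ι x) (ι y)
                 (subst (_< i) (position x) (inL⇒< φ i x x∈L))
                 (subst (_< i) (position y) (inL⇒< φ i y y∈L)) eq) (ι v)
                 (subst (i ≤_) (position v) (inR⇒≥ φ i v v∈R))
    in trans (arc-ι x v) (trans (proj₁ same) (sym (arc-ι y v))) ,
       trans (arc-ι v x) (trans (proj₂ same) (sym (arc-ι v y)))

width≤-from-LNLC : ∀ G k → LNLCBuildable G k → HasDNW≤ G k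
width≤-from-LNLC G k (e , iso) = width≤-from-labellings G k ⟦ e ⟧nlc iso (classLabellingNLC e)

width≤-from-LCW : ∀ G k → LCWBuildable G k → HasDNW≤ G k
width≤-from-LCW G k (e , iso) = width≤-from-labellings G k ⟦ e ⟧lcw iso (classLabellingLCW e)

clamp : ∀ {m} → ℕ → Fin (suc m)
clamp {zero}  _       = zero
clamp {suc m} zero    = zero
clamp {suc m} (suc x) = suc (clamp x)

toℕ-clamp : ∀ {m} x → x ≤ m → toℕ (clamp {m} x) ≡ x
toℕ-clamp {zero}  zero    _         = refl
toℕ-clamp {suc m} zero    _         = refl
toℕ-clamp {suc m} (suc x) (s≤s x≤m) = cong suc (toℕ-clamp x x≤m)

digraph : ∀ {N} (ar : Fin N → Fin N → Bool) → (∀ u → ar u u ≡ false) → Digraph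
digraph {N} ar ir = record { n = N ; arc = ar ; irrefl = ir }

-- A labelling scheme with k labels for a vertex sequence p 0, p 1, … of G.
-- lbl j t < k is the label of p t once p 0, …, p (j ∸ 1) exist (t < j);
-- the label of an old vertex determines its arcs to and from the next
-- vertex p j, and labels evolve by the relabelling next j when p j is added.
record LabelScheme (G : Digraph) (p : ℕ → Fin (n G)) (k : ℕ) : Set where
  field
    lbl           : ℕ → ℕ → ℕ
    next          : ℕ → ℕ → ℕ
    toNew fromNew : ℕ → ℕ → Bool
    lbl<k         : ∀ {j t} → t < j → j ≤ n G → lbl j t < k
    lbl-next      : ∀ {j t} → t < j → j < n G → lbl (suc j) t ≡ next j (lbl j t)
    lbl-toNew     : ∀ {j t} → t < j → j < n G → toNew j (lbl j t) ≡ arc G (p t) (p j)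
    lbl-fromNew   : ∀ {j t} → t < j → j < n G → fromNew j (lbl j t) ≡ arc G (p j) (p t)

Monotone : ∀ {G p k} → LabelScheme G p k → Set
Monotone {G} S = ∀ {j t} → t < j → j < n G → next j (lbl j t) ≤ lbl j t
  where open LabelScheme S

-- A layout φ of width ≤ k yields a monotone labelling scheme with k labels
-- for the vertices in layout order: the label of a vertex at cut j is the
-- index of its neighbourhood class N_j in the list of classes met so far.
module LayoutScheme {n′ : ℕ} (ar : Fin (suc n′) → Fin (suc n′) → Bool) (ir : ∀ u → ar u u ≡ false)
                    (k : ℕ) (φ : Layout (suc n′)) (width≤k : ∀ i → numClasses (digraph ar ir) φ i ≤ k) where

  G : Digraph
  G = digraph ar ir

  vertex : ℕ → Fin (suc n′)
  vertex t = φ ⟨$⟩ˡ clamp t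

  position-vertex : ∀ {t} → t ≤ n′ → toℕ (φ ⟨$⟩ʳ vertex t) ≡ t
  position-vertex t≤n′ = trans (cong toℕ (inverseʳ φ)) (toℕ-clamp _ t≤n′)

  nbh : ℕ → Fin (suc n′) → Nb (suc n′)
  nbh = Nbh G φ

  nbh-at-next : ∀ {j} → j ≤ n′ → ∀ u →
    lookup (proj₁ (nbh j u)) (vertex j) ≡ ar u (vertex j) ×
    lookup (proj₂ (nbh j u)) (vertex j) ≡ ar (vertex j) u
  nbh-at-next {j} j≤n′ u
    rewrite lookup∘tabulate (λ v → inR φ j v ∧ ar u v) (vertex j)
          | lookup∘tabulate (λ v → inR φ j v ∧ ar v u) (vertex j)
          | ≥⇒inR φ j (vertex j) (subst (j ≤_) (sym (position-vertex j≤n′)) ≤-refl)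
    = refl , refl

  restrict : ℕ → Nb (suc n′) → Nb (suc n′)
  restrict c (outs , ins) = tabulate (λ v → inR φ c v ∧ lookup outs v)
                          , tabulate (λ v → inR φ c v ∧ lookup ins v)

  restrict-nbh : ∀ c u → restrict (suc c) (nbh c u) ≡ nbh (suc c) u
  restrict-nbh c u = cong₂ _,_ (tabulate-cong (shrink (ar u))) (tabulate-cong (shrink (λ v → ar v u)))
    where
    -- R(c+1, φ) ⊆ R(c, φ)
    shrink : (f : Fin (suc n′) → Bool) → ∀ v →
      (inR φ (suc c) v ∧ lookup (tabulate (λ w → inR φ c w ∧ f w)) v) ≡ (inR φ (suc c) v ∧ f v)
    shrink f v rewrite lookup∘tabulate (λ w → inR φ c w ∧ f w) v with inR φ (suc c) v in v∈R
    ... | false = refl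
    ... | true rewrite ≥⇒inR φ c v (<⇒≤ (inR⇒≥ φ (suc c) v v∈R)) = refl

  -- classes j lists, without repetition, the classes N_j of vertex 0, …,
  -- vertex (j ∸ 1), in the order in which they first appear
  classes : ℕ → List (Nb (suc n′))
  classes zero    = []
  classes (suc j) = deduplicate _≟ᴺ_ (map (restrict (suc j)) (classes j) ++ [ nbh (suc j) (vertex j) ])

  classes-complete : ∀ {j t} → t < j → nbh j (vertex t) ∈ classes j
  classes-complete {suc j} {t} t<1+j with m<1+n⇒m<n∨m≡n t<1+j
  ... | inj₁ t<j  = ∈-deduplicate⁺ _≟ᴺ_ (∈-++⁺ˡ (subst (_∈ map (restrict (suc j)) (classes j)) (restrict-nbh j (vertex t))
                      (∈-map⁺ (restrict (suc j)) (classes-complete t<j))))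
  ... | inj₂ refl = ∈-deduplicate⁺ _≟ᴺ_ (∈-++⁺ʳ (map (restrict (suc j)) (classes j)) (here refl))

  classes-sound : ∀ j {c} → c ∈ classes j → Σ ℕ λ t → t < j × c ≡ nbh j (vertex t)
  classes-sound (suc j) {c} c∈
    with ∈-++⁻ (map (restrict (suc j)) (classes j))
               (∈-deduplicate⁻ _≟ᴺ_ (map (restrict (suc j)) (classes j) ++ [ nbh (suc j) (vertex j) ]) c∈)
  ... | inj₂ (here c≡) = j , ≤-refl , c≡
  ... | inj₁ c∈map with ∈-map⁻ (restrict (suc j)) c∈map
  ...   | d , d∈ , refl with classes-sound j d∈
  ...     | t , t<j , refl = t , <⇒≤ (s≤s t<j) , restrict-nbh j (vertex t)

  classes-unique : ∀ j → Unique (classes j)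
  classes-unique zero    = []
  classes-unique (suc j) = deduplicate-! _≟ᴺ_ _

  -- the classes met so far are among the ≤ k classes at cut j
  classes-length : ∀ {j} → j ≤ suc n′ → length (classes j) ≤ k
  classes-length {j} j≤N = ≤-trans (unique-⊆-length≤ (classes j) _ (classes-unique j) ⊆cut) (width≤k j)
    where
    ⊆cut : classes j ⊆ deduplicate _≟ᴺ_ (map (nbh j) (filter (λ u → inL φ j u ≟ᴮ true) (allFin (suc n′))))
    ⊆cut c∈ with classes-sound j c∈
    ... | t , t<j , refl = ∈-deduplicate⁺ _≟ᴺ_ (∈-map⁺ (nbh j) (∈-filter⁺ (λ u → inL φ j u ≟ᴮ true) (∈-allFin (vertex t))
            (<⇒inL φ j (vertex t) (subst (_< j) (sym (position-vertex (≤-pred (≤-trans t<j j≤N)))) t<j))))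

  open FirstIndex _≟ᴺ_ (nbh 0 (vertex 0))

  scheme : LabelScheme G vertex k
  scheme = record
    { lbl         = λ j t → indexOf (classes j) (nbh j (vertex t))
    ; next        = λ j ℓ → indexOf (classes (suc j)) (restrict (suc j) (entryAt (classes j) ℓ))
    ; toNew       = λ j ℓ → lookup (proj₁ (entryAt (classes j) ℓ)) (vertex j)
    ; fromNew     = λ j ℓ → lookup (proj₂ (entryAt (classes j) ℓ)) (vertex j)
    ; lbl<k       = λ t<j j≤N → <-≤-trans (indexOf<length _ (classes-complete t<j)) (classes-length j≤N)
    ; lbl-next    = λ {j} {t} t<j _ → cong (indexOf (classes (suc j)))
                      (trans (sym (restrict-nbh j (vertex t))) (cong (restrict (suc j)) (sym (entry t<j))))
    ; lbl-toNew   = λ {j} {t} t<j j<N → trans (cong (λ c → lookup (proj₁ c) (vertex j)) (entry t<j))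
                                              (proj₁ (nbh-at-next (≤-pred j<N) (vertex t)))
    ; lbl-fromNew = λ {j} {t} t<j j<N → trans (cong (λ c → lookup (proj₂ c) (vertex j)) (entry t<j))
                                              (proj₂ (nbh-at-next (≤-pred j<N) (vertex t)))
    }
    where
    entry : ∀ {j t} → t < j → entryAt (classes j) (indexOf (classes j) (nbh j (vertex t))) ≡ nbh j (vertex t)
    entry t<j = entryAt-indexOf _ (classes-complete t<j)

  -- merging classes only moves them to the front of the list
  scheme-monotone : Monotone scheme
  scheme-monotone {j} {t} t<j _ =
    subst (_≤ indexOf (classes j) (nbh j (vertex t)))
      (cong (λ c → indexOf (classes (suc j)) (restrict (suc j) c))
            (sym (entryAt-indexOf (classes j) (classes-complete t<j))))
      (indexOf-deduplicate-map (restrict (suc j)) (classes j) _ (classes-complete t<j))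

  -- the order in which the constructions below create the vertices
  order : Permutation′ (suc n′)
  order = reverse ∘ₚ flip φ

  order-vertex : ∀ u → order ⟨$⟩ʳ u ≡ vertex (n′ ∸ toℕ u)
  order-vertex u = cong (φ ⟨$⟩ˡ_) (toℕ-injective
    (trans (opposite-prop u) (sym (toℕ-clamp (n′ ∸ toℕ u) (m∸n≤m n′ (toℕ u))))))

anyBelow : ℕ → (ℕ → Bool) → Bool
anyBelow zero    f = false
anyBelow (suc t) f = anyBelow t f ∨ f t

anyBelow-false : ∀ t (f : ℕ → Bool) → (∀ ℓ → ℓ < t → f ℓ ≡ false) → anyBelow t f ≡ false
anyBelow-false zero    f _    = refl
anyBelow-false (suc t) f none =
  cong₂ _∨_ (anyBelow-false t f (λ ℓ ℓ<t → none ℓ (m<n⇒m<1+n ℓ<t))) (none t ≤-refl)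

anyBelow-single : ∀ t (f : ℕ → Bool) {ℓ₀} → ℓ₀ < t
  → (∀ ℓ → ℓ < t → ℓ ≢ ℓ₀ → f ℓ ≡ false) → anyBelow t f ≡ f ℓ₀
anyBelow-single (suc t) f ℓ₀<1+t others with m<1+n⇒m<n∨m≡n ℓ₀<1+t
... | inj₁ ℓ₀<t = trans
  (cong₂ _∨_ (anyBelow-single t f ℓ₀<t (λ ℓ ℓ<t → others ℓ (m<n⇒m<1+n ℓ<t)))
             (others t ≤-refl (λ t≡ℓ₀ → <-irrefl (sym t≡ℓ₀) ℓ₀<t)))
  (∨-identityʳ _)
... | inj₂ refl = cong (_∨ f t) (anyBelow-false t f (λ ℓ ℓ<t → others ℓ (m<n⇒m<1+n ℓ<t) (λ ℓ≡t → <-irrefl ℓ≡t ℓ<t)))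

==-refl : ∀ {K} (a : Fin K) → (a == a) ≡ true
==-refl a with a ≟ᶠ a
... | yes _   = refl
... | no  a≢a = ⊥-elim (a≢a refl)

==-≢ : ∀ {K} {a b : Fin K} → a ≢ b → (a == b) ≡ false
==-≢ {a = a} {b} a≢b with a ≟ᶠ b
... | yes a≡b = ⊥-elim (a≢b a≡b)
... | no  _   = refl

rel-hit : ∀ {K m} (e : LCWExpr K m) {a b} x → label ⟦ e ⟧lcw x ≡ a → label ⟦ rel e a b ⟧lcw x ≡ b
rel-hit e x refl rewrite ==-refl (label ⟦ e ⟧lcw x) = refl

rel-miss : ∀ {K m} (e : LCWExpr K m) {a b} x → label ⟦ e ⟧lcw x ≢ a → label ⟦ rel e a b ⟧lcw x ≡ label ⟦ e ⟧lcw x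
rel-miss e x ≢a rewrite ==-≢ ≢a = refl

-- α_{a,b} if the condition c holds; skipped when a = b, where α is not allowed.
arcsIf : ∀ {K m} → Bool → Fin K → Fin K → LCWExpr K m → LCWExpr K m
arcsIf false a b e = e
arcsIf true  a b e with a ≟ᶠ b
... | yes _   = e
... | no  a≢b = arcs e a b a≢b

arcsIf-label : ∀ {K m} c (a b : Fin K) (e : LCWExpr K m) x → label ⟦ arcsIf c a b e ⟧lcw x ≡ label ⟦ e ⟧lcw x
arcsIf-label false a b e x = refl
arcsIf-label true  a b e x with a ≟ᶠ b
... | yes _ = refl
... | no  _ = refl

arcsIf-larc : ∀ {K m} c {a b : Fin K} (e : LCWExpr K m) x y → a ≢ b →
  larc ⟦ arcsIf c a b e ⟧lcw x y ≡ (larc ⟦ e ⟧lcw x y ∨ (c ∧ (label ⟦ e ⟧lcw x == a ∧ label ⟦ e ⟧lcw y == b)))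
arcsIf-larc false e x y _ = sym (∨-identityʳ _)
arcsIf-larc true {a} {b} e x y a≢b with a ≟ᶠ b
... | yes a≡b = ⊥-elim (a≢b a≡b)
... | no  _   = refl

ℕ-case : ∀ {A : Set} → A → (ℕ → A) → ℕ → A
ℕ-case a f zero    = a
ℕ-case a f (suc ℓ) = f ℓ

-- From a labelling scheme with k labels for an enumeration p of G we build
-- expressions with k + 1 labels: the vertex just added carries the label
-- new, every older vertex p t the label old (lbl j t).  The expression for
-- p 0, …, p j has vertex u standing for p (j ∸ u).
module Builders {n′ : ℕ} (ar : Fin (suc n′) → Fin (suc n′) → Bool) (ir : ∀ u → ar u u ≡ false)
                {k : ℕ} (p : ℕ → Fin (suc n′)) (S : LabelScheme (digraph ar ir) p k)
                (order : Permutation′ (suc n′)) (order-p : ∀ u → order ⟨$⟩ʳ u ≡ p (n′ ∸ toℕ u)) where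

  open LabelScheme S

  G : Digraph
  G = digraph ar ir

  new : Fin (suc k)
  new = zero

  old : ℕ → Fin (suc k)
  old ℓ = clamp (suc ℓ)

  toℕ-old : ∀ {ℓ} → ℓ < k → toℕ (old ℓ) ≡ suc ℓ
  toℕ-old ℓ<k = toℕ-clamp _ ℓ<k

  old≢new : ∀ {ℓ} → ℓ < k → old ℓ ≢ new
  old≢new ℓ<k eq with trans (sym (toℕ-old ℓ<k)) (cong toℕ eq)
  ... | ()

  old-≢ : ∀ {ℓ ℓ′} → ℓ < k → ℓ′ < k → ℓ ≢ ℓ′ → old ℓ ≢ old ℓ′
  old-≢ ℓ<k ℓ′<k ℓ≢ℓ′ eq = ℓ≢ℓ′ (suc-injective (trans (sym (toℕ-old ℓ<k)) (trans (cong toℕ eq) (toℕ-old ℓ′<k))))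

  onLabel : ∀ {A : Set} → A → (ℕ → A) → Fin (suc k) → A
  onLabel a f b = ℕ-case a f (toℕ b)

  onLabel-old : ∀ {A : Set} {a : A} {f ℓ} → ℓ < k → onLabel a f (old ℓ) ≡ f ℓ
  onLabel-old {a = a} {f} ℓ<k = cong (ℕ-case a f) (toℕ-old ℓ<k)

  vertexAt : ∀ j → Fin (suc j) → Fin (suc n′)
  vertexAt j u = p (j ∸ toℕ u)

  stage< : ∀ {j} (u : Fin (suc j)) → j ∸ toℕ u < suc j
  stage< {j} u = s≤s (m∸n≤m j (toℕ u))

  iso-from-arcs : (H : LDigraph (suc k) (suc n′)) →
    (∀ u w → larc H u w ≡ ar (vertexAt n′ u) (vertexAt n′ w)) → Iso G H
  iso-from-arcs H H-arcs = order , λ u w → trans (cong₂ ar (order-p u) (order-p w)) (sym (H-arcs u w))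

  -- Linear NLC-width: insert p j with arcs read off the old labels, then
  -- relabel everything by next j (old) and lbl (suc j) j (new).
  relabelAt : ℕ → Fin (suc k) → Fin (suc k)
  relabelAt j = onLabel (old (lbl (suc j) j)) (λ ℓ → old (next j ℓ))

  buildNLC : (j : ℕ) → LNLCExpr (suc k) (suc j)
  buildNLC zero    = relab (vtx new) (relabelAt 0)
  buildNLC (suc j) = relab (ext (buildNLC j) (λ b _ → onLabel false (toNew (suc j)) b)
                                             (λ b _ → onLabel false (fromNew (suc j)) b) new)
                           (relabelAt (suc j))

  label-buildNLC : ∀ {j} → j ≤ n′ → ∀ u → label ⟦ buildNLC j ⟧nlc u ≡ old (lbl (suc j) (j ∸ toℕ u))
  label-buildNLC {zero}  _      zero    = refl
  label-buildNLC {suc j} _      zero    = refl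
  label-buildNLC {suc j} 1+j≤n′ (suc u) = begin
    relabelAt (suc j) (label ⟦ buildNLC j ⟧nlc u)  ≡⟨ cong (relabelAt (suc j)) (label-buildNLC (<⇒≤ 1+j≤n′) u) ⟩
    relabelAt (suc j) (old (lbl (suc j) t))        ≡⟨ onLabel-old (lbl<k (stage< u) (s≤s (<⇒≤ 1+j≤n′))) ⟩
    old (next (suc j) (lbl (suc j) t))             ≡⟨ cong old (sym (lbl-next (stage< u) (s≤s 1+j≤n′))) ⟩
    old (lbl (suc (suc j)) t)                      ∎
    where t = j ∸ toℕ u

  arc-buildNLC : ∀ {j} → j ≤ n′ → ∀ u w → larc ⟦ buildNLC j ⟧nlc u w ≡ ar (vertexAt j u) (vertexAt j w)
  arc-buildNLC {zero}  _      zero    zero    = sym (ir _)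
  arc-buildNLC {suc j} _      zero    zero    = sym (ir _)
  arc-buildNLC {suc j} 1+j≤n′ (suc u) zero    = begin
    onLabel false (toNew (suc j)) (label ⟦ buildNLC j ⟧nlc u)
      ≡⟨ cong (onLabel false (toNew (suc j))) (label-buildNLC (<⇒≤ 1+j≤n′) u) ⟩
    onLabel false (toNew (suc j)) (old (lbl (suc j) (j ∸ toℕ u)))
      ≡⟨ onLabel-old (lbl<k (stage< u) (s≤s (<⇒≤ 1+j≤n′))) ⟩
    toNew (suc j) (lbl (suc j) (j ∸ toℕ u))
      ≡⟨ lbl-toNew (stage< u) (s≤s 1+j≤n′) ⟩
    ar (p (j ∸ toℕ u)) (p (suc j)) ∎
  arc-buildNLC {suc j} 1+j≤n′ zero    (suc w) = begin
    onLabel false (fromNew (suc j)) (label ⟦ buildNLC j ⟧nlc w)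
      ≡⟨ cong (onLabel false (fromNew (suc j))) (label-buildNLC (<⇒≤ 1+j≤n′) w) ⟩
    onLabel false (fromNew (suc j)) (old (lbl (suc j) (j ∸ toℕ w)))
      ≡⟨ onLabel-old (lbl<k (stage< w) (s≤s (<⇒≤ 1+j≤n′))) ⟩
    fromNew (suc j) (lbl (suc j) (j ∸ toℕ w))
      ≡⟨ lbl-fromNew (stage< w) (s≤s 1+j≤n′) ⟩
    ar (p (suc j)) (p (j ∸ toℕ w)) ∎
  arc-buildNLC {suc j} 1+j≤n′ (suc u) (suc w) = arc-buildNLC (<⇒≤ 1+j≤n′) u w

  nlcBuildable : LNLCBuildable G (suc k)
  nlcBuildable = buildNLC n′ , iso-from-arcs ⟦ buildNLC n′ ⟧nlc (arc-buildNLC ≤-refl)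

  -- Linear clique-width, step j: add p j labelled new, join it to the old
  -- labels (joinNew), relabel old ℓ to old (next j ℓ) for ℓ = 0, 1, …
  -- (relabelOld), and finally relabel new to its own class.
  -- The arcs joinNew adds between vertices labelled a and b, per old label ℓ:
  joined : ℕ → Fin (suc k) → Fin (suc k) → ℕ → Bool
  joined j a b ℓ = (toNew j ℓ ∧ (a == old ℓ ∧ b == new)) ∨ (fromNew j ℓ ∧ (a == new ∧ b == old ℓ))

  joinNew : ∀ {m} → ℕ → ℕ → LCWExpr (suc k) m → LCWExpr (suc k) m
  joinNew j zero    e = e
  joinNew j (suc ℓ) e = arcsIf (fromNew j ℓ) new (old ℓ) (arcsIf (toNew j ℓ) (old ℓ) new (joinNew j ℓ e))

  joinNew-label : ∀ {m} j t (e : LCWExpr (suc k) m) x → label ⟦ joinNew j t e ⟧lcw x ≡ label ⟦ e ⟧lcw x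
  joinNew-label j zero    e x = refl
  joinNew-label j (suc t) e x =
    trans (arcsIf-label (fromNew j t) new (old t) _ x)
          (trans (arcsIf-label (toNew j t) (old t) new _ x) (joinNew-label j t e x))

  joinNew-larc : ∀ {m} j t (e : LCWExpr (suc k) m) x y → t ≤ k →
    larc ⟦ joinNew j t e ⟧lcw x y ≡ (larc ⟦ e ⟧lcw x y ∨ anyBelow t (joined j (label ⟦ e ⟧lcw x) (label ⟦ e ⟧lcw y)))
  joinNew-larc j zero e x y _ = sym (∨-identityʳ _)
  joinNew-larc j (suc t) e x y t<k
    rewrite arcsIf-larc (fromNew j t) (arcsIf (toNew j t) (old t) new (joinNew j t e)) x y (λ eq → old≢new t<k (sym eq))
          | arcsIf-larc (toNew j t) (joinNew j t e) x y (old≢new t<k)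
          | arcsIf-label (toNew j t) (old t) new (joinNew j t e) x
          | arcsIf-label (toNew j t) (old t) new (joinNew j t e) y
          | joinNew-label j t e x
          | joinNew-label j t e y
          | joinNew-larc j t e x y (<⇒≤ t<k)
    = ∨-reassoc (larc ⟦ e ⟧lcw x y) (anyBelow t (joined j lx ly))
                (toNew j t ∧ (lx == old t ∧ ly == new)) (fromNew j t ∧ (lx == new ∧ ly == old t))
    where
    lx = label ⟦ e ⟧lcw x
    ly = label ⟦ e ⟧lcw y
    ∨-reassoc : ∀ a b c d → (((a ∨ b) ∨ c) ∨ d) ≡ (a ∨ (b ∨ (c ∨ d)))
    ∨-reassoc a b c d = trans (∨-assoc (a ∨ b) c d) (∨-assoc a b (c ∨ d))

  joined-old-old : ∀ j {a b} → a ≢ new → b ≢ new → ∀ ℓ → joined j a b ℓ ≡ false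
  joined-old-old j {a} a≢new b≢new ℓ
    rewrite ==-≢ a≢new | ==-≢ b≢new | ∧-zeroʳ (a == old ℓ) | ∧-zeroʳ (toNew j ℓ) | ∧-zeroʳ (fromNew j ℓ) = refl

  joined-new-new : ∀ j {ℓ} → ℓ < k → joined j new new ℓ ≡ false
  joined-new-new j {ℓ} ℓ<k
    rewrite ==-≢ (λ eq → old≢new ℓ<k (sym eq)) | ∧-zeroʳ (toNew j ℓ) | ∧-zeroʳ (fromNew j ℓ) = refl

  joined-old-new : ∀ j {ℓ₀} → ℓ₀ < k → anyBelow k (joined j (old ℓ₀) new) ≡ toNew j ℓ₀
  joined-old-new j {ℓ₀} ℓ₀<k = trans (anyBelow-single k _ ℓ₀<k others) at-ℓ₀
    where
    others : ∀ ℓ → ℓ < k → ℓ ≢ ℓ₀ → joined j (old ℓ₀) new ℓ ≡ false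
    others ℓ ℓ<k ℓ≢ℓ₀ rewrite ==-≢ (old-≢ ℓ₀<k ℓ<k (λ eq → ℓ≢ℓ₀ (sym eq))) | ==-≢ (old≢new ℓ₀<k)
                            | ∧-zeroʳ (toNew j ℓ) | ∧-zeroʳ (fromNew j ℓ) = refl
    at-ℓ₀ : joined j (old ℓ₀) new ℓ₀ ≡ toNew j ℓ₀
    at-ℓ₀ rewrite ==-refl (old ℓ₀) | ==-≢ (old≢new ℓ₀<k) | ∧-identityʳ (toNew j ℓ₀) | ∧-zeroʳ (fromNew j ℓ₀) =
      ∨-identityʳ _

  joined-new-old : ∀ j {ℓ₀} → ℓ₀ < k → anyBelow k (joined j new (old ℓ₀)) ≡ fromNew j ℓ₀
  joined-new-old j {ℓ₀} ℓ₀<k = trans (anyBelow-single k _ ℓ₀<k others) at-ℓ₀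
    where
    others : ∀ ℓ → ℓ < k → ℓ ≢ ℓ₀ → joined j new (old ℓ₀) ℓ ≡ false
    others ℓ ℓ<k ℓ≢ℓ₀ rewrite ==-≢ (old-≢ ℓ₀<k ℓ<k (λ eq → ℓ≢ℓ₀ (sym eq))) | ==-≢ (old≢new ℓ₀<k)
                            | ∧-zeroʳ (new == old ℓ) | ∧-zeroʳ (toNew j ℓ) | ∧-zeroʳ (fromNew j ℓ) = refl
    at-ℓ₀ : joined j new (old ℓ₀) ℓ₀ ≡ fromNew j ℓ₀
    at-ℓ₀ rewrite ==-refl (old ℓ₀) | ==-≢ (old≢new ℓ₀<k) | ∧-zeroʳ (new == old ℓ₀)
                | ∧-zeroʳ (toNew j ℓ₀) | ∧-identityʳ (fromNew j ℓ₀) = refl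

  relabelOld : ∀ {m} → ℕ → ℕ → LCWExpr (suc k) m → LCWExpr (suc k) m
  relabelOld j zero    e = e
  relabelOld j (suc ℓ) e = rel (relabelOld j ℓ e) (old ℓ) (old (next j ℓ))

  relabelOld-larc : ∀ {m} j t (e : LCWExpr (suc k) m) x y → larc ⟦ relabelOld j t e ⟧lcw x y ≡ larc ⟦ e ⟧lcw x y
  relabelOld-larc j zero    e x y = refl
  relabelOld-larc j (suc t) e x y = relabelOld-larc j t e x y

  relabelOld-new : ∀ {m} j t (e : LCWExpr (suc k) m) x → t ≤ k →
    label ⟦ e ⟧lcw x ≡ new → label ⟦ relabelOld j t e ⟧lcw x ≡ new
  relabelOld-new j zero    e x _   is-new = is-new
  relabelOld-new j (suc t) e x t<k is-new =
    trans (rel-miss (relabelOld j t e) x (λ eq → old≢new t<k (trans (sym eq) IH))) IH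
    where IH = relabelOld-new j t e x (<⇒≤ t<k) is-new

  -- a vertex labelled old ℓ₀ is untouched by the relabellings of labels below ℓ₀ ...
  relabelOld-before : ∀ {m} j t (e : LCWExpr (suc k) m) x {ℓ₀} → t ≤ ℓ₀ → ℓ₀ < k →
    label ⟦ e ⟧lcw x ≡ old ℓ₀ → label ⟦ relabelOld j t e ⟧lcw x ≡ old ℓ₀
  relabelOld-before j zero    e x _     _    is-ℓ₀ = is-ℓ₀
  relabelOld-before j (suc t) e x t<ℓ₀ ℓ₀<k is-ℓ₀ =
    trans (rel-miss (relabelOld j t e) x
             (λ eq → old-≢ ℓ₀<k (<-trans t<ℓ₀ ℓ₀<k) (λ ℓ₀≡t → <-irrefl (sym ℓ₀≡t) t<ℓ₀) (trans (sym IH) eq)))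
          IH
    where
    IH = relabelOld-before j t e x (<⇒≤ t<ℓ₀) ℓ₀<k is-ℓ₀

  -- ... receives old (next j ℓ₀) at step ℓ₀, and keeps it since next j ℓ₀ ≤ ℓ₀.
  relabelOld-after : ∀ {m} j t (e : LCWExpr (suc k) m) x {ℓ₀} → ℓ₀ < t → t ≤ k → next j ℓ₀ ≤ ℓ₀ →
    label ⟦ e ⟧lcw x ≡ old ℓ₀ → label ⟦ relabelOld j t e ⟧lcw x ≡ old (next j ℓ₀)
  relabelOld-after j (suc t) e x ℓ₀<1+t t<k next≤ℓ₀ is-ℓ₀ with m<1+n⇒m<n∨m≡n ℓ₀<1+t
  ... | inj₁ ℓ₀<t = trans (rel-miss (relabelOld j t e) x
                      (λ eq → old-≢ (≤-<-trans next≤ℓ₀ (≤-<-trans (<⇒≤ ℓ₀<t) t<k)) t<k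
                                (λ next≡t → <-irrefl next≡t (≤-<-trans next≤ℓ₀ ℓ₀<t)) (trans (sym IH) eq)))
                      IH
    where IH = relabelOld-after j t e x ℓ₀<t (<⇒≤ t<k) next≤ℓ₀ is-ℓ₀
  ... | inj₂ refl = rel-hit (relabelOld j t e) x (relabelOld-before j t e x ≤-refl t<k is-ℓ₀)

  module _ (monotone : Monotone S) where

    buildLCW : (j : ℕ) → LCWExpr (suc k) (suc j)
    buildLCW zero    = rel (vtx new) new (old (lbl 1 0))
    buildLCW (suc j) = rel (relabelOld (suc j) k (joinNew (suc j) k (add (buildLCW j) new)))
                           new (old (lbl (suc (suc j)) (suc j)))

    label-buildLCW : ∀ {j} → j ≤ n′ → ∀ u → label ⟦ buildLCW j ⟧lcw u ≡ old (lbl (suc j) (j ∸ toℕ u))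
    label-buildLCW {zero}  _      zero    = rel-hit (vtx new) zero refl
    label-buildLCW {suc j} 1+j≤n′ zero    =
      rel-hit (relabelOld (suc j) k E) zero
        (relabelOld-new (suc j) k E zero ≤-refl (joinNew-label (suc j) k (add (buildLCW j) new) zero))
      where E = joinNew (suc j) k (add (buildLCW j) new)
    label-buildLCW {suc j} 1+j≤n′ (suc u) = begin
      label ⟦ buildLCW (suc j) ⟧lcw (suc u)
        ≡⟨ rel-miss (relabelOld (suc j) k E) (suc u) (λ eq → old≢new next<k (trans (sym relabelled) eq)) ⟩
      label ⟦ relabelOld (suc j) k E ⟧lcw (suc u)
        ≡⟨ relabelOld-after (suc j) k E (suc u) ℓ₀<k ≤-refl (monotone (stage< u) 1+j<N) is-ℓ₀ ⟩
      old (next (suc j) ℓ₀)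
        ≡⟨ cong old (sym (lbl-next (stage< u) 1+j<N)) ⟩
      old (lbl (suc (suc j)) (j ∸ toℕ u)) ∎
      where
      E = joinNew (suc j) k (add (buildLCW j) new)
      ℓ₀ = lbl (suc j) (j ∸ toℕ u)
      1+j<N = s≤s 1+j≤n′
      ℓ₀<k = lbl<k (stage< u) (s≤s (<⇒≤ 1+j≤n′))
      next<k = ≤-<-trans (monotone (stage< u) 1+j<N) ℓ₀<k
      is-ℓ₀ : label ⟦ E ⟧lcw (suc u) ≡ old ℓ₀
      is-ℓ₀ = trans (joinNew-label (suc j) k (add (buildLCW j) new) (suc u)) (label-buildLCW (<⇒≤ 1+j≤n′) u)
      relabelled = relabelOld-after (suc j) k E (suc u) ℓ₀<k ≤-refl (monotone (stage< u) 1+j<N) is-ℓ₀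

    arc-buildLCW : ∀ {j} → j ≤ n′ → ∀ u w → larc ⟦ buildLCW j ⟧lcw u w ≡ ar (vertexAt j u) (vertexAt j w)
    arc-buildLCW {zero}  _      zero zero = sym (ir _)
    arc-buildLCW {suc j} 1+j≤n′ u    w    =
      trans (relabelOld-larc (suc j) k (joinNew (suc j) k E) u w)
            (trans (joinNew-larc (suc j) k E u w ≤-refl) (joined-arcs u w))
      where
      E = add (buildLCW j) new
      j≤n′ = <⇒≤ 1+j≤n′
      old-label : ∀ u → label ⟦ buildLCW j ⟧lcw u ≡ old (lbl (suc j) (j ∸ toℕ u))
      old-label = label-buildLCW j≤n′
      old-label<k : ∀ u → lbl (suc j) (j ∸ toℕ u) < k
      old-label<k u = lbl<k (stage< u) (s≤s j≤n′)
      old-label≢new : ∀ u → label ⟦ buildLCW j ⟧lcw u ≢ new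
      old-label≢new u eq = old≢new (old-label<k u) (trans (sym (old-label u)) eq)
      joined-arcs : ∀ u w → (larc ⟦ E ⟧lcw u w ∨ anyBelow k (joined (suc j) (label ⟦ E ⟧lcw u) (label ⟦ E ⟧lcw w)))
                            ≡ ar (vertexAt (suc j) u) (vertexAt (suc j) w)
      joined-arcs zero    zero    = trans (anyBelow-false k _ (λ ℓ ℓ<k → joined-new-new (suc j) ℓ<k)) (sym (ir _))
      joined-arcs (suc u) zero    =
        trans (cong (λ a → anyBelow k (joined (suc j) a new)) (old-label u))
              (trans (joined-old-new (suc j) (old-label<k u)) (lbl-toNew (stage< u) (s≤s 1+j≤n′)))
      joined-arcs zero    (suc w) =
        trans (cong (λ b → anyBelow k (joined (suc j) new b)) (old-label w))
              (trans (joined-new-old (suc j) (old-label<k w)) (lbl-fromNew (stage< w) (s≤s 1+j≤n′)))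
      joined-arcs (suc u) (suc w) =
        trans (cong (larc ⟦ buildLCW j ⟧lcw u w ∨_)
                    (anyBelow-false k _ (λ ℓ _ → joined-old-old (suc j) (old-label≢new u) (old-label≢new w) ℓ)))
              (trans (∨-identityʳ _) (arc-buildLCW j≤n′ u w))

    lcwBuildable : LCWBuildable G (suc k)
    lcwBuildable = buildLCW n′ , iso-from-arcs ⟦ buildLCW n′ ⟧lcw (arc-buildLCW ≤-refl)

lnlc-size-positive : ∀ {k m} → LNLCExpr k m → 0 < m
lnlc-size-positive (vtx _)       = s≤s z≤n
lnlc-size-positive (ext _ _ _ _) = s≤s z≤n
lnlc-size-positive (relab e _)   = lnlc-size-positive e

buildable-from-width : ∀ G k → 0 < n G → HasDNW≤ G k → LNLCBuildable G (suc k) × LCWBuildable G (suc k)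
buildable-from-width record { n = zero } k () _
buildable-from-width record { n = suc n′ ; arc = ar ; irrefl = ir } k _ (φ , width≤k) =
  nlcBuildable , lcwBuildable scheme-monotone
  where
  open LayoutScheme ar ir k φ width≤k using (vertex; scheme; scheme-monotone; order; order-vertex)
  open Builders ar ir vertex scheme order order-vertex using (nlcBuildable; lcwBuildable)

-- Minimality of d-nw against the lower-bound witnesses gives d-nw ≤ d-lnlcw
-- and d-nw ≤ d-lcw; minimality of d-lnlcw and d-lcw against the upper-bound
-- constructions (G is nonempty, as it has an NLC-width expression) gives the rest.
lemma5p2 : (G : Digraph) (nw lnlcw lcw : ℕ)
    → IsDNW G nw → IsDLNLCW G lnlcw → IsDLCW G lcw
    → (nw ≤ lnlcw × lnlcw ≤ nw + 1) × (nw ≤ lcw × lcw ≤ nw + 1)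
lemma5p2 G nw lnlcw lcw (layout , nw-least) (nlc , lnlcw-least) (lcw-expr , lcw-least) =
  (nw-least lnlcw (width≤-from-LNLC G lnlcw nlc) , plus-one (lnlcw-least (suc nw) (proj₁ upper))) ,
  (nw-least lcw (width≤-from-LCW G lcw lcw-expr) , plus-one (lcw-least (suc nw) (proj₂ upper)))
  where
  upper = buildable-from-width G nw (lnlc-size-positive (proj₁ nlc)) layout
  plus-one : ∀ {w} → w ≤ suc nw → w ≤ nw + 1
  plus-one {w} = subst (w ≤_) (+-comm 1 nw)
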